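{- Let $\mathbb{C}$ be a small coconfluent category and let $P$ be an atomic sheaf on $\mathbb{C}$. For each object $X$ of $\mathbb{C}$ define $$\sim_P(X) := \{(x,x') \in P(X)\times P(X) \mid \exists Z\ \exists u,u' \colon Z \to X \text{ in } \mathbb{C}.\ x\cdot u = x'\cdot u'\}.$$ Then: (i) for every morphism $f\colon Y\to X$ in $\mathbb{C}$ and every $(x,x')\in \sim_P(X)$ we have $(x\cdot f, x'\cdot f)\in \sim_P(Y)$; (ii) for every morphism $f\colon Y \to X$ and every $(x,x')\in P(X)\times P(X)$, if $(x\cdot f,x'\cdot f)\in\sim_P(Y)$ then $(x,x')\in\sim_P(X)$; so $\sim_P$ is a subsheaf of $P\times P$. Moreover (iii) for every object $X$, $\sim_P(X)$ is an equivalence relation on $P(X)$.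
   Context: A presheaf on a small category $\mathbb{C}$ is a functor $P\colon \mathbb{C}^{op}\to\mathbf{Set}$; for $f\colon Y\to X$ and $x\in P(X)$ write $x\cdot f := P(f)(x)\in P(Y)$. $\mathbb{C}$ is coconfluent if every cospan $X\xrightarrow{f} Z\xleftarrow{g} Y$ admits a span $X\xleftarrow{u} W\xrightarrow{v} Y$ with $f\circ u = g\circ v$. For $c\colon Y\to X$, an element $y\in P(Y)$ is $c$-invariant if $y\cdot d = y\cdot e$ for all $d,e\colon Z\to Y$ with $c\circ d = c\circ e$; an element $x\in P(X)$ is a $c$-descendent of $y$ if $y = x\cdot c$. $P$ is an atomic sheaf if for every $c\colon Y\to X$ every $c$-invariant $y\in P(Y)$ has a unique $c$-descendent. The product presheaf $P\times P$ is computed pointwise, $(x,x')\cdot f = (x\cdot f,x'\cdot f)$. For a sheaf $P$, a family of subsets $Q(X)\subseteq P(X)$ determines a subsheaf exactly when conditions of the form (i) (closure under restriction) and (ii) (reflection along restriction) hold. -}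

module Defs where

open import Level using (Level; _⊔_; suc)
open import Data.Product using (Σ; _×_; _,_; ∃-syntax)
open import Relation.Binary.PropositionalEquality using (_≡_)
open import Relation.Binary.Structures using (IsEquivalence)

record Category (o h : Level) : Set (suc (o ⊔ h)) where
  infixr 9 _∘_
  field
    Obj   : Set o
    Hom   : Obj → Obj → Set h
    id    : ∀ {X} → Hom X X
    _∘_   : ∀ {X Y Z} → Hom Y Z → Hom X Y → Hom X Z
    identityˡ : ∀ {X Y} (f : Hom X Y) → id ∘ f ≡ f
    identityʳ : ∀ {X Y} (f : Hom X Y) → f ∘ id ≡ f
    assoc : ∀ {W X Y Z} (h : Hom Y Z) (g : Hom X Y) (f : Hom W X) →
            (h ∘ g) ∘ f ≡ h ∘ (g ∘ f)

module _ {o h : Level} (C : Category o h) where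
  open Category C

  Coconfluent : Set (o ⊔ h)
  Coconfluent = ∀ {X Y Z} (f : Hom X Z) (g : Hom Y Z) →
    Σ Obj λ W → Σ (Hom W X) λ u → Σ (Hom W Y) λ v → f ∘ u ≡ g ∘ v

  -- Presheaf C^op → Set, written with right action x · f := P(f)(x).
  record Presheaf (p : Level) : Set (o ⊔ h ⊔ suc p) where
    infixl 8 _·_
    field
      F₀  : Obj → Set p
      _·_ : ∀ {X Y} → F₀ X → Hom Y X → F₀ Y
      ·-id : ∀ {X} (x : F₀ X) → x · id ≡ x
      ·-∘  : ∀ {X Y Z} (x : F₀ X) (f : Hom Y X) (g : Hom Z Y) →
             x · (f ∘ g) ≡ (x · f) · g

  module _ {p : Level} (P : Presheaf p) where
    open Presheaf P

    Invariant : ∀ {X Y} → Hom Y X → F₀ Y → Set (o ⊔ h ⊔ p)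
    Invariant {X} {Y} c y = ∀ {Z} (d e : Hom Z Y) → c ∘ d ≡ c ∘ e → y · d ≡ y · e

    Descendent : ∀ {X Y} → Hom Y X → F₀ Y → F₀ X → Set p
    Descendent c y x = y ≡ x · c

    AtomicSheaf : Set (o ⊔ h ⊔ p)
    AtomicSheaf = ∀ {X Y} (c : Hom Y X) (y : F₀ Y) → Invariant c y →
      Σ (F₀ X) λ x → Descendent c y x × (∀ x' → Descendent c y x' → x' ≡ x)

    ∼P : ∀ X → F₀ X → F₀ X → Set (o ⊔ h ⊔ p)
    ∼P X x x' = Σ Obj λ Z → Σ (Hom Z X) λ u → Σ (Hom Z X) λ u' → x · u ≡ x' · u'

{-# OPTIONS --safe #-}
module Submission where

-- Idea: a witness x · u ≡ x' · u' stays a witness after restricting both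
-- sides along any further map, and coconfluence completes every cospan to a
-- commuting square.  Together these let two witnesses be glued (transitivity)
-- and a witness be moved along f : Y → X (part (i)).  Part (ii), reflexivity
-- and symmetry hold in every presheaf.

open import Defs
open import Level using (Level)
open import Data.Product using (_×_; _,_)
open import Relation.Binary.Structures using (IsEquivalence)
open import Relation.Binary.PropositionalEquality using (_≡_; refl; sym; cong; module ≡-Reasoning)

module _ {o h p : Level} (C : Category o h) (P : Presheaf C p) where
  open Category C
  open Presheaf P
  open ≡-Reasoning

  ·-square : ∀ {W X Y Z} {f : Hom X Z} {g : Hom Y Z} {u : Hom W X} {v : Hom W Y}
             (z : F₀ Z) → f ∘ u ≡ g ∘ v → z · f · u ≡ z · g · v
  ·-square {f = f} {g} {u} {v} z fu≡gv = begin
    z · f · u   ≡⟨ ·-∘ z f u ⟨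
    z · (f ∘ u) ≡⟨ cong (z ·_) fu≡gv ⟩
    z · (g ∘ v) ≡⟨ ·-∘ z g v ⟩
    z · g · v   ∎

  restrictions≡⇒∼P : ∀ {X Y Y' Z} {x x' : F₀ X}
                     (f : Hom Y X) (f' : Hom Y' X) (g : Hom Z Y) (g' : Hom Z Y') →
                     x · f · g ≡ x' · f' · g' → ∼P C P X x x'
  restrictions≡⇒∼P {Z = Z} {x} {x'} f f' g g' e = Z , f ∘ g , f' ∘ g' , (begin
    x · (f ∘ g)    ≡⟨ ·-∘ x f g ⟩
    x · f · g      ≡⟨ e ⟩
    x' · f' · g'   ≡⟨ ·-∘ x' f' g' ⟨
    x' · (f' ∘ g') ∎)

  ∼P-reflect : ∀ {X Y} (f : Hom Y X) (x x' : F₀ X) →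
               ∼P C P Y (x · f) (x' · f) → ∼P C P X x x'
  ∼P-reflect f x x' (Z , v , v' , e) = restrictions≡⇒∼P f f v v' e

  ∼P-refl : ∀ {X} {x : F₀ X} → ∼P C P X x x
  ∼P-refl {X} = X , id , id , refl

  ∼P-sym : ∀ {X} {x x' : F₀ X} → ∼P C P X x x' → ∼P C P X x' x
  ∼P-sym (Z , u , u' , e) = Z , u' , u , sym e

  module _ (coconfluent : Coconfluent C) where

    ∼P-trans : ∀ {X} {x y z : F₀ X} → ∼P C P X x y → ∼P C P X y z → ∼P C P X x z
    ∼P-trans {x = x} {y} {z} (_ , u , u' , e) (_ , w , w' , e')
      with _ , a , b , u'a≡wb ← coconfluent u' w
      = restrictions≡⇒∼P u w' a b (begin
        x · u · a   ≡⟨ cong (_· a) e ⟩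
        y · u' · a  ≡⟨ ·-square y u'a≡wb ⟩
        y · w · b   ≡⟨ cong (_· b) e' ⟩
        z · w' · b  ∎)

    ∼P-isEquivalence : ∀ X → IsEquivalence (∼P C P X)
    ∼P-isEquivalence X = record { refl = ∼P-refl ; sym = ∼P-sym ; trans = ∼P-trans }

    ∼P-restrict : ∀ {X Y} (f : Hom Y X) (x x' : F₀ X) →
                  ∼P C P X x x' → ∼P C P Y (x · f) (x' · f)
    ∼P-restrict f x x' (_ , u , u' , e)
      with _ , a , b , fa≡ub ← coconfluent f u
      with _ , c , d , u'bc≡fd ← coconfluent (u' ∘ b) f
      = _ , a ∘ c , d , (begin
        x · f · (a ∘ c)    ≡⟨ ·-∘ (x · f) a c ⟩
        x · f · a · c      ≡⟨ cong (_· c) (·-square x fa≡ub) ⟩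
        x · u · b · c      ≡⟨ cong (λ y → y · b · c) e ⟩
        x' · u' · b · c    ≡⟨ cong (_· c) (·-∘ x' u' b) ⟨
        x' · (u' ∘ b) · c  ≡⟨ ·-square x' u'bc≡fd ⟩
        x' · f · d         ∎)

theorem5p1 : ∀ {o h p : Level} (C : Category o h) → Coconfluent C →
    (P : Presheaf C p) → AtomicSheaf C P →
    let open Category C
        open Presheaf P
    in ((∀ {X Y} (f : Hom Y X) (x x' : F₀ X) → ∼P C P X x x' → ∼P C P Y (x · f) (x' · f))
       × (∀ {X Y} (f : Hom Y X) (x x' : F₀ X) → ∼P C P Y (x · f) (x' · f) → ∼P C P X x x'))
       × (∀ X → IsEquivalence (∼P C P X))
theorem5p1 C coconfluent P _ =
  (∼P-restrict C P coconfluent , ∼P-reflect C P) , ∼P-isEquivalence C P coconfluent
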